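{- Let $q > r \ge 1$ be integers. If $S$ is a $K_q^r$-clique, then there exists a $K_q^r$-booster for $S$.
   Context: An $r$-graph is identified with its edge set (a set of $r$-element subsets of its vertex set $V(G)$). $K_q^r$ is the complete $r$-graph on $q$ vertices, and a $K_q^r$-clique is an $r$-graph isomorphic to $K_q^r$. A $K_q^r$-decomposition of an $r$-graph $G$ is a partition of the edges of $G$ into $K_q^r$-cliques. A set $U$ of vertices is independent in an $r$-graph $B$ if no edge of $B$ is contained in $U$. A $K_q^r$-booster for a $K_q^r$-clique $S$ is an $r$-graph $B$ with $V(S) \subseteq V(B)$ such that $V(S)$ is independent in $B$, $B$ has a $K_q^r$-decomposition $\mathrm{Off}(B)$, and $B \cup S$ has a $K_q^r$-decomposition $\mathrm{On}(B)$ with $S \notin \mathrm{On}(B)$. -}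

module Defs where

open import Data.Nat using (ℕ; _<_)
open import Data.List using (List; length; _++_)
open import Data.List.Membership.Propositional using (_∈_)
open import Data.List.Relation.Unary.Linked using (Linked)
open import Data.Product using (Σ; _×_; ∃)
open import Data.Fin using (Fin)
open import Data.List.Base using (lookup)
open import Relation.Binary.PropositionalEquality using (_≡_)
open import Relation.Nullary using (¬_)
open import Function.Bundles using (_⇔_)

-- Vertices are natural numbers.  A finite vertex set is represented by
-- its strictly increasing enumeration (so set equality is list equality).
IsSet : List ℕ → Set
IsSet xs = Linked _<_ xs

IsRSet : ℕ → List ℕ → Set
IsRSet r e = IsSet e × length e ≡ r

_⊆_ : List ℕ → List ℕ → Set
xs ⊆ ys = ∀ {x} → x ∈ xs → x ∈ ys

-- An r-graph is (identified with) a finite set of r-sets, given as a list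
-- of edges; the list is read as a set (membership is what matters).
RGraph : Set
RGraph = List (List ℕ)

IsRGraph : ℕ → RGraph → Set
IsRGraph r G = ∀ {e} → e ∈ G → IsRSet r e

_≈G_ : RGraph → RGraph → Set
G ≈G H = ∀ e → (e ∈ G) ⇔ (e ∈ H)

IsClique : ℕ → ℕ → RGraph → Set
IsClique q r C =
  Σ (List ℕ) λ U → IsRSet q U ×
    (∀ e → (e ∈ C) ⇔ (IsRSet r e × e ⊆ U))

_∈V_ : ℕ → RGraph → Set
x ∈V G = Σ (List ℕ) λ f → f ∈ G × x ∈ f

IndependentIn : RGraph → RGraph → Set
IndependentIn S B = ∀ {e} → e ∈ B → ¬ (∀ {x} → x ∈ e → x ∈V S)

IsDecomposition : ℕ → ℕ → List RGraph → RGraph → Set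
IsDecomposition q r D G =
  (∀ {C} → C ∈ D → IsClique q r C) ×
  (∀ {C} → C ∈ D → ∀ {e} → e ∈ C → e ∈ G) ×
  (∀ {e} → e ∈ G →
     Σ (Fin (length D)) λ i → e ∈ lookup D i ×
       (∀ (j : Fin (length D)) → e ∈ lookup D j → j ≡ i))

HasDecomposition : ℕ → ℕ → RGraph → Set
HasDecomposition q r G = Σ (List RGraph) λ D → IsDecomposition q r D G

-- B is a K_q^r-booster for the clique S  (V(S) ⊆ V(B) is automatic, as the
-- vertex set of B may be taken to be V(B) ∪ V(S))
IsBooster : ℕ → ℕ → RGraph → RGraph → Set
IsBooster q r S B =
  IsRGraph r B ×
  IndependentIn S B ×
  HasDecomposition q r B ×
  Σ (List RGraph) λ On →
    IsDecomposition q r On (B ++ S) ×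
    (∀ {C} → C ∈ On → ¬ (C ≈G S))

{-# OPTIONS --safe #-}
-- Let U be the vertex set of S, b ≥ max U, m = (b + 1)! + 1 and N = m ^ r.  Take as vertices the
-- pairs (u , a) with u ∈ U and a < m, encoded as u + a (b + 1), so that (u , 0) is u itself; a word
-- c : U → ℤ/m then spans the K_q^r-clique on {(u , c u) : u ∈ U}.  Consider the words of the
-- polynomials of degree < r (N of them, the zero polynomial giving S) and of the same polynomials
-- plus x ^ r.  Distinct points of U differ by units modulo m, so a polynomial of degree < r vanishing
-- modulo m at r of them has all coefficients divisible by m: two words of the same family agreeing on
-- r positions are equal.  Since x ^ r − ∏_{s ∈ I} (x − s) has degree < r, on every r-set I each word of
-- one family agrees with a word of the other.  Hence the cliques of the nonzero words of the first
-- family decompose their union B, the cliques of the second family decompose B ∪ S, and none of the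
-- latter is S, as a monic polynomial of degree r cannot vanish at all q > r points of U.  Finally an
-- edge of B inside U would be an edge of S, the clique of the zero word.

module Submission where

open import Defs
open import Data.Nat as ℕ using (ℕ; zero; suc; _≤_; _<_; s≤s; z≤n)
import Data.Nat.Properties as ℕP
open import Data.Nat.Properties using (_≟_; <-trans; <-irrefl; ≤∧≢⇒<; ≤-trans; ≤-decTotalOrder; suc-injective)
import Data.Nat.DivMod as DM
import Data.Nat.Divisibility as ℕDiv
import Data.Nat.Coprimality as ℕC
open import Data.Integer as ℤ using (ℤ; +_; _+_; _*_; _-_; -_; _^_; 0ℤ; 1ℤ; -1ℤ; _%ℕ_; _/ℕ_)
open import Data.Integer.Properties using (+-identityˡ; +-identityʳ; *-zeroʳ; m-n≡m⊖n; ∣⊖∣-≤; ∣m⊖n∣≡∣n⊖m∣)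
open import Data.Integer.DivMod using (a≡a%ℕn+[a/ℕn]*n; n%ℕd<d)
open import Data.Integer.Divisibility.Signed as Signed using (divides; ∣ᵤ⇒∣; ∣⇒∣ᵤ; ∣m∣n⇒∣m+n; ∣m⇒∣-m; ∣m⇒∣m*n)
open import Data.Integer.Coprimality using (Coprime; coprime-divisor)
open import Data.Integer.Tactic.RingSolver using (solve-∀)
open import Data.Fin as Fin using (Fin)
open import Data.List using (List; []; _∷_; length; _++_; map; take; lookup; [_]; upTo; applyUpTo; concatMap)
open import Data.List.Properties using (length-map; length-++; map-∘)
open import Data.List.Extrema.Nat using (max; xs≤max)
open import Data.List.Membership.Propositional using (_∈_; find; lose)
open import Data.List.Membership.Propositional.Properties
  using (∈-map⁺; ∈-map⁻; ∈-++⁺ˡ; ∈-++⁺ʳ; ∈-++⁻; ∈-lookup; ∈-upTo⁺; ∈-upTo⁻; ∈-applyUpTo⁺; ∈-applyUpTo⁻;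
         ∈-concatMap⁺; ∈-concatMap⁻)
open import Data.List.Relation.Unary.Any using (here; there; index)
open import Data.List.Relation.Unary.Any.Properties using (lookup-index)
open import Data.List.Relation.Unary.All as All using (All; []; _∷_)
import Data.List.Relation.Unary.All.Properties as AllP
open import Data.List.Relation.Unary.AllPairs as AllPairs using (AllPairs; []; _∷_)
import Data.List.Relation.Unary.AllPairs.Properties as AllPairsP
open import Data.List.Relation.Unary.Linked.Properties using (AllPairs⇒Linked; Linked⇒AllPairs)
open import Data.List.Relation.Unary.Unique.Propositional using (Unique)
import Data.List.Relation.Unary.Unique.Propositional.Properties as UniqueP
open import Data.List.Relation.Binary.Permutation.Propositional using (↭⇒↭ₛ; ↭-sym)
open import Data.List.Relation.Binary.Permutation.Propositional.Properties using (∈-resp-↭; ↭-length)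
open import Data.List.Sort ≤-decTotalOrder using (sort; sort-↭; sort-↗)
open import Data.Product using (Σ; _×_; _,_; proj₁; proj₂; map₂)
open import Data.Sum using (inj₁; inj₂; [_,_]′)
open import Function using (_∘′_)
open import Function.Bundles using (_⇔_; mk⇔; Equivalence)
open import Relation.Nullary using (¬_; yes; no; contradiction)
open import Relation.Binary.Bundles using (Setoid)
open import Relation.Binary.Structures using (IsEquivalence)
import Relation.Binary.Reasoning.Setoid
open import Relation.Binary.PropositionalEquality
  using (_≡_; _≢_; refl; sym; trans; cong; cong₂; subst; subst₂; module ≡-Reasoning)
open import Relation.Binary.PropositionalEquality.Properties using (setoid)
open import Data.List.Relation.Binary.Permutation.Setoid.Properties (setoid ℕ) using (Unique-resp-↭)

-- Finite vertex sets and complete r-graphs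

Strict : List ℕ → Set
Strict = AllPairs _<_

IsSet⇒Strict : ∀ {xs} → IsSet xs → Strict xs
IsSet⇒Strict = Linked⇒AllPairs <-trans

AllPairs-map-All : ∀ {A : Set} {P : A → Set} {R S : A → A → Set} →
                   (∀ {x y} → P x → P y → R x y → S x y) → ∀ {xs} → All P xs → AllPairs R xs → AllPairs S xs
AllPairs-map-All f []         []           = []
AllPairs-map-All f (px ∷ pxs) (rxs ∷ rxss) =
  All.zipWith (λ (py , r) → f px py r) (pxs , rxs) ∷ AllPairs-map-All f pxs rxss

combinations : {A : Set} → ℕ → List A → List (List A)
combinations zero    _        = [] ∷ []
combinations (suc r) []       = []
combinations (suc r) (x ∷ xs) = map (x ∷_) (combinations r xs) ++ combinations (suc r) xs

∈-combinations⁻ : ∀ r {U e} → Strict U → e ∈ combinations r U →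
                  Strict e × length e ≡ r × e ⊆ U
∈-combinations⁻ zero _ (here refl) = [] , refl , λ ()
∈-combinations⁻ (suc r) {x ∷ xs} (x<xs ∷ xs↑) e∈
  with ∈-++⁻ (map (x ∷_) (combinations r xs)) e∈
... | inj₂ e∈′ = let e↑ , |e| , e⊆ = ∈-combinations⁻ (suc r) xs↑ e∈′ in e↑ , |e| , there ∘′ e⊆
... | inj₁ e∈′ with ∈-map⁻ (x ∷_) e∈′
... | e′ , e′∈ , refl =
  let e′↑ , |e′| , e′⊆ = ∈-combinations⁻ r xs↑ e′∈ in
  All.tabulate (All.lookup x<xs ∘′ e′⊆) ∷ e′↑ , cong suc |e′| ,
  λ { (here refl) → here refl ; (there y∈e′) → there (e′⊆ y∈e′) }

∈-combinations⁺ : ∀ r {U e} → Strict U → Strict e → length e ≡ r → e ⊆ U →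
                  e ∈ combinations r U
∈-combinations⁺ zero    {e = []} _ _ _ _ = here refl
∈-combinations⁺ (suc r) {[]} {y ∷ e} _ _ _ e⊆ with e⊆ (here refl)
... | ()
∈-combinations⁺ (suc r) {x ∷ xs} {y ∷ e} (x<xs ∷ xs↑) (y<e ∷ e↑) |e| e⊆ with y ≟ x
... | yes refl = ∈-++⁺ˡ (∈-map⁺ (y ∷_) (∈-combinations⁺ r xs↑ e↑ (suc-injective |e|) e⊆xs))
  where
  e⊆xs : e ⊆ xs
  e⊆xs z∈e with e⊆ (there z∈e)
  ... | here refl = contradiction (All.lookup y<e z∈e) (<-irrefl refl)
  ... | there z∈xs = z∈xs
... | no y≢x = ∈-++⁺ʳ _ (∈-combinations⁺ (suc r) xs↑ (y<e ∷ e↑) |e| ye⊆xs)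
  where
  y∈xs : y ∈ xs
  y∈xs with e⊆ (here refl)
  ... | here y≡x = contradiction y≡x y≢x
  ... | there y∈xs = y∈xs
  ye⊆xs : (y ∷ e) ⊆ xs
  ye⊆xs (here refl) = y∈xs
  ye⊆xs (there z∈e) with e⊆ (there z∈e)
  ... | here refl = contradiction (<-trans (All.lookup x<xs y∈xs) (All.lookup y<e z∈e)) (<-irrefl refl)
  ... | there z∈xs = z∈xs

take-∈-combinations : ∀ {A : Set} r (W : List A) → r ≤ length W → take r W ∈ combinations r W
take-∈-combinations zero    _       _         = here refl
take-∈-combinations (suc r) (x ∷ W) (s≤s r≤) = ∈-++⁺ˡ (∈-map⁺ (x ∷_) (take-∈-combinations r W r≤))

∈-some-combination : ∀ {A : Set} r (W : List A) {x} → 1 ≤ r → r ≤ length W → x ∈ W →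
                     Σ (List A) λ e → e ∈ combinations r W × x ∈ e
∈-some-combination (suc r) (x ∷ W) _ (s≤s r≤) (here refl) =
  x ∷ take r W , ∈-++⁺ˡ (∈-map⁺ (x ∷_) (take-∈-combinations r W r≤)) , here refl
∈-some-combination 1 (y ∷ z ∷ W) _ _ (there x∈) =
  let e , e∈ , x∈e = ∈-some-combination 1 (z ∷ W) (s≤s z≤n) (s≤s z≤n) x∈ in
  e , ∈-++⁺ʳ ((y ∷ []) ∷ []) e∈ , x∈e
∈-some-combination (suc (suc r)) (y ∷ W) _ (s≤s r≤) (there x∈) =
  let e , e∈ , x∈e = ∈-some-combination (suc r) W (s≤s z≤n) r≤ x∈ in
  y ∷ e , ∈-++⁺ˡ (∈-map⁺ (y ∷_) e∈) , there x∈e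

∈-combinations : ∀ r {U} → Strict U → ∀ e → (e ∈ combinations r U) ⇔ (IsRSet r e × e ⊆ U)
∈-combinations r {U} U↑ e = mk⇔ to from
  where
  to : e ∈ combinations r U → IsRSet r e × e ⊆ U
  to e∈ = let e↑ , |e| , e⊆ = ∈-combinations⁻ r U↑ e∈ in (AllPairs⇒Linked e↑ , |e|) , e⊆
  from : IsRSet r e × e ⊆ U → e ∈ combinations r U
  from ((e↑ , |e|) , e⊆) = ∈-combinations⁺ r U↑ (IsSet⇒Strict e↑) |e| e⊆

clique-covers : ∀ {r U} {C : RGraph} → 1 ≤ r → r ≤ length U → IsSet U →
                (∀ e → (e ∈ C) ⇔ (IsRSet r e × e ⊆ U)) → ∀ {x} → x ∈ U → x ∈V C
clique-covers {r} {U} 1≤r r≤|U| U↑ C⇔ x∈U =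
  let e , e∈ , x∈e = ∈-some-combination r U 1≤r r≤|U| x∈U in
  e , Equivalence.from (C⇔ e) (Equivalence.to (∈-combinations r (IsSet⇒Strict U↑) e) e∈) , x∈e

sort-Strict : ∀ {W} → Unique W → Strict (sort W)
sort-Strict {W} W! =
  AllPairs.zipWith (λ (x≤y , x≢y) → ≤∧≢⇒< x≤y x≢y)
    (Linked⇒AllPairs ≤-trans (sort-↗ W) , Unique-resp-↭ (↭⇒↭ₛ (↭-sym (sort-↭ W))) W!)

complete : ℕ → List ℕ → RGraph
complete r W = combinations r (sort W)

∈-complete : ∀ r {W} → Unique W → ∀ e → (e ∈ complete r W) ⇔ (IsRSet r e × e ⊆ W)
∈-complete r {W} W! e = mk⇔
  (λ e∈ → map₂ (λ e⊆ {x} x∈e → ∈-resp-↭ (sort-↭ W) (e⊆ x∈e)) (to e∈))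
  (λ (e↑ , e⊆) → from (e↑ , λ {x} x∈e → ∈-resp-↭ (↭-sym (sort-↭ W)) (e⊆ x∈e)))
  where open Equivalence (∈-combinations r (sort-Strict W!) e)

complete-isClique : ∀ r {W} → Unique W → IsClique (length W) r (complete r W)
complete-isClique r {W} W! =
  sort W , (AllPairs⇒Linked (sort-Strict W!) , ↭-length (sort-↭ W)) , ∈-combinations r (sort-Strict W!)

-- Decompositions indexed by a list

module _ {A : Set} (F : A → RGraph) where

  index-unique : ∀ {I : List A} → Unique I → ∀ {a e} (a∈I : a ∈ I) →
                 (∀ {b} → b ∈ I → e ∈ F b → b ≡ a) →
                 ∀ j → e ∈ lookup (map F I) j → j ≡ index (∈-map⁺ F a∈I)
  index-unique _ (here refl) _ Fin.zero _ = refl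
  index-unique {x ∷ I} (x∉I ∷ _) {e = e} (here refl) only (Fin.suc j) e∈
    with ∈-map⁻ F (∈-lookup {xs = map F I} j)
  ... | b , b∈I , Fj≡Fb =
    contradiction (sym (only (there b∈I) (subst (e ∈_) Fj≡Fb e∈))) (All.lookup x∉I b∈I)
  index-unique (x∉I ∷ _) (there a∈I) only Fin.zero e∈ =
    contradiction (only (here refl) e∈) (All.lookup x∉I a∈I)
  index-unique (_ ∷ I!) (there a∈I) only (Fin.suc j) e∈ =
    cong Fin.suc (index-unique I! a∈I (only ∘′ there) j e∈)

  family-isDecomposition :
    ∀ q r {G} (I : List A) → Unique I →
    (∀ {a} → a ∈ I → IsClique q r (F a)) →
    (∀ {a e} → a ∈ I → e ∈ F a → e ∈ G) →
    (∀ {e} → e ∈ G → Σ A λ a → a ∈ I × e ∈ F a) →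
    (∀ {a b e} → a ∈ I → b ∈ I → e ∈ F a → e ∈ F b → a ≡ b) →
    IsDecomposition q r (map F I) G
  family-isDecomposition q r {G} I I! clique ⊆G cover disjoint = isClique , sub , exactlyOne
    where
    isClique : ∀ {C} → C ∈ map F I → IsClique q r C
    isClique C∈ with ∈-map⁻ F C∈
    ... | a , a∈I , refl = clique a∈I
    sub : ∀ {C} → C ∈ map F I → ∀ {e} → e ∈ C → e ∈ G
    sub C∈ e∈C with ∈-map⁻ F C∈
    ... | a , a∈I , refl = ⊆G a∈I e∈C
    exactlyOne : ∀ {e} → e ∈ G → Σ (Fin (length (map F I))) λ i → e ∈ lookup (map F I) i ×
                   (∀ j → e ∈ lookup (map F I) j → j ≡ i)
    exactlyOne {e} e∈G with cover e∈G
    ... | a , a∈I , e∈Fa =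
      index (∈-map⁺ F a∈I) , subst (e ∈_) (lookup-index (∈-map⁺ F a∈I)) e∈Fa ,
      index-unique I! a∈I (λ b∈I e∈Fb → disjoint b∈I a∈I e∈Fb e∈Fa)

-- Integer polynomials, as coefficient lists with the constant term first

eval : List ℤ → ℤ → ℤ
eval []       x = 0ℤ
eval (c ∷ cs) x = c + x * eval cs x

_⊕_ : List ℤ → List ℤ → List ℤ
[]       ⊕ q        = q
(c ∷ cs) ⊕ []       = c ∷ cs
(c ∷ cs) ⊕ (d ∷ ds) = (c + d) ∷ (cs ⊕ ds)

eval-⊕ : ∀ p q x → eval (p ⊕ q) x ≡ eval p x + eval q x
eval-⊕ []       q        x = sym (+-identityˡ (eval q x))
eval-⊕ (c ∷ cs) []       x = sym (+-identityʳ (eval (c ∷ cs) x))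
eval-⊕ (c ∷ cs) (d ∷ ds) x = begin
  (c + d) + x * eval (cs ⊕ ds) x         ≡⟨ cong (λ y → (c + d) + x * y) (eval-⊕ cs ds x) ⟩
  (c + d) + x * (eval cs x + eval ds x)  ≡⟨ distribute c d x (eval cs x) (eval ds x) ⟩
  (c + x * eval cs x) + (d + x * eval ds x) ∎
  where
  open ≡-Reasoning
  distribute : ∀ c d x a b → (c + d) + x * (a + b) ≡ (c + x * a) + (d + x * b)
  distribute = solve-∀

length-⊕ : ∀ p q → length p ≡ length q → length (p ⊕ q) ≡ length p
length-⊕ []       []       _ = refl
length-⊕ (c ∷ cs) (d ∷ ds) e = cong suc (length-⊕ cs ds (ℕP.suc-injective e))

eval-scale : ∀ a p x → eval (map (a *_) p) x ≡ a * eval p x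
eval-scale a []       x = sym (*-zeroʳ a)
eval-scale a (c ∷ cs) x = begin
  a * c + x * eval (map (a *_) cs) x ≡⟨ cong (λ y → a * c + x * y) (eval-scale a cs x) ⟩
  a * c + x * (a * eval cs x)        ≡⟨ factor a c x (eval cs x) ⟩
  a * (c + x * eval cs x)            ∎
  where
  open ≡-Reasoning
  factor : ∀ a c x y → a * c + x * (a * y) ≡ a * (c + x * y)
  factor = solve-∀

eval-++-leading : ∀ p x → eval (p ++ [ 1ℤ ]) x ≡ eval p x + x ^ length p
eval-++-leading []       x = monomial x
  where
  monomial : ∀ x → 1ℤ + x * 0ℤ ≡ 0ℤ + 1ℤ
  monomial = solve-∀
eval-++-leading (c ∷ cs) x = begin
  c + x * eval (cs ++ [ 1ℤ ]) x         ≡⟨ cong (λ y → c + x * y) (eval-++-leading cs x) ⟩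
  c + x * (eval cs x + x ^ length cs)   ≡⟨ distribute c x (eval cs x) (x ^ length cs) ⟩
  (c + x * eval cs x) + x * x ^ length cs ∎
  where
  open ≡-Reasoning
  distribute : ∀ c x a b → c + x * (a + b) ≡ (c + x * a) + x * b
  distribute = solve-∀

quotient : ℤ → List ℤ → List ℤ
quotient t []       = []
quotient t (d ∷ ds) = eval (d ∷ ds) t ∷ quotient t ds

length-quotient : ∀ t cs → length (quotient t cs) ≡ length cs
length-quotient t []       = refl
length-quotient t (d ∷ ds) = cong suc (length-quotient t ds)

eval-quotient : ∀ t c cs x → eval (c ∷ cs) x ≡ eval (c ∷ cs) t + (x - t) * eval (quotient t cs) x
eval-quotient t c []       x = constant c t x
  where
  constant : ∀ c t x → c + x * 0ℤ ≡ (c + t * 0ℤ) + (x - t) * 0ℤ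
  constant = solve-∀
eval-quotient t c (d ∷ ds) x = begin
  c + x * eval (d ∷ ds) x                          ≡⟨ cong (λ y → c + x * y) (eval-quotient t d ds x) ⟩
  c + x * (p[t] + (x - t) * eval (quotient t ds) x) ≡⟨ regroup c x t p[t] (eval (quotient t ds) x) ⟩
  (c + t * p[t]) + (x - t) * (p[t] + x * eval (quotient t ds) x) ∎
  where
  open ≡-Reasoning
  p[t] = eval (d ∷ ds) t
  regroup : ∀ c x t a q → c + x * (a + (x - t) * q) ≡ (c + t * a) + (x - t) * (a + x * q)
  regroup = solve-∀

-- ∏_{s ∈ I} (x − s) = x ^ |I| + lowerPart I
lowerPart : List ℤ → List ℤ
lowerPart []      = []
lowerPart (s ∷ I) = (0ℤ ∷ lowerPart I) ⊕ map (- s *_) (lowerPart I ++ [ 1ℤ ])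

length-lowerPart : ∀ I → length (lowerPart I) ≡ length I
length-lowerPart []      = refl
length-lowerPart (s ∷ I) =
  trans (length-⊕ (0ℤ ∷ lowerPart I) shifted (sym |shifted|)) (cong suc (length-lowerPart I))
  where
  shifted = map (- s *_) (lowerPart I ++ [ 1ℤ ])
  |shifted| : length shifted ≡ suc (length (lowerPart I))
  |shifted| = trans (length-map _ (lowerPart I ++ [ 1ℤ ])) (trans (length-++ (lowerPart I)) (ℕP.+-comm _ 1))

monic : List ℤ → ℤ → ℤ
monic I x = eval (lowerPart I) x + x ^ length I

monic-∷ : ∀ s I x → monic (s ∷ I) x ≡ (x - s) * monic I x
monic-∷ s I x = begin
  eval ((0ℤ ∷ L) ⊕ map (- s *_) (L ++ [ 1ℤ ])) x + x * x ^ n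
    ≡⟨ cong (_+ x * x ^ n) (eval-⊕ (0ℤ ∷ L) (map (- s *_) (L ++ [ 1ℤ ])) x) ⟩
  (0ℤ + x * eval L x) + eval (map (- s *_) (L ++ [ 1ℤ ])) x + x * x ^ n
    ≡⟨ cong (λ y → (0ℤ + x * eval L x) + y + x * x ^ n)
            (trans (eval-scale (- s) (L ++ [ 1ℤ ]) x) (cong (- s *_) tail)) ⟩
  (0ℤ + x * eval L x) + - s * (eval L x + x ^ n) + x * x ^ n
    ≡⟨ factor x s (eval L x) (x ^ n) ⟩
  (x - s) * (eval L x + x ^ n) ∎
  where
  open ≡-Reasoning
  L = lowerPart I
  n = length I
  tail : eval (L ++ [ 1ℤ ]) x ≡ eval L x + x ^ n
  tail = trans (eval-++-leading L x) (cong (λ k → eval L x + x ^ k) (length-lowerPart I))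
  factor : ∀ x s e p → (0ℤ + x * e) + - s * (e + p) + x * p ≡ (x - s) * (e + p)
  factor = solve-∀

monic-root : ∀ I {s} → s ∈ I → monic I s ≡ 0ℤ
monic-root (s ∷ I) (here refl) = trans (monic-∷ s I s) (vanish s (monic I s))
  where
  vanish : ∀ s y → (s - s) * y ≡ 0ℤ
  vanish = solve-∀
monic-root (t ∷ I) {s} (there s∈I) =
  trans (monic-∷ t I s) (trans (cong ((s - t) *_) (monic-root I s∈I)) (*-zeroʳ (s - t)))

powerInterpolant : List ℤ → List ℤ
powerInterpolant I = map (-1ℤ *_) (lowerPart I)

length-powerInterpolant : ∀ I → length (powerInterpolant I) ≡ length I
length-powerInterpolant I = trans (length-map _ (lowerPart I)) (length-lowerPart I)

eval-powerInterpolant : ∀ I {s} → s ∈ I → eval (powerInterpolant I) s ≡ s ^ length I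
eval-powerInterpolant I {s} s∈I = begin
  eval (map (-1ℤ *_) L) s              ≡⟨ eval-scale -1ℤ L s ⟩
  -1ℤ * eval L s                       ≡⟨ complement (eval L s) (s ^ length I) ⟩
  -1ℤ * monic I s + s ^ length I       ≡⟨ cong (λ y → -1ℤ * y + s ^ length I) (monic-root I s∈I) ⟩
  -1ℤ * 0ℤ + s ^ length I              ≡⟨ +-identityˡ (s ^ length I) ⟩
  s ^ length I                         ∎
  where
  open ≡-Reasoning
  L = lowerPart I
  complement : ∀ e p → -1ℤ * e ≡ -1ℤ * (e + p) + p
  complement = solve-∀

-- Congruences, polynomials and codewords modulo m

zeroOffset : ℕ → ℤ
zeroOffset _ = 0ℤ

power : ℕ → ℕ → ℤ
power r s = (+ s) ^ r

∣+a-+b∣ : ∀ a b → ℤ.∣ + a - + b ∣ ≡ ℕ.∣ a - b ∣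
∣+a-+b∣ a b with ℕP.≤-total a b
... | inj₁ a≤b = trans (cong ℤ.∣_∣ (m-n≡m⊖n a b)) (trans (∣⊖∣-≤ a≤b) (sym (ℕP.m≤n⇒∣m-n∣≡n∸m a≤b)))
... | inj₂ b≤a = begin
  ℤ.∣ + a - + b ∣ ≡⟨ cong ℤ.∣_∣ (m-n≡m⊖n a b) ⟩
  ℤ.∣ a ℤ.⊖ b ∣   ≡⟨ ∣m⊖n∣≡∣n⊖m∣ a b ⟩
  ℤ.∣ b ℤ.⊖ a ∣   ≡⟨ ∣⊖∣-≤ b≤a ⟩
  a ℕ.∸ b         ≡⟨ ℕP.m≤n⇒∣m-n∣≡n∸m b≤a ⟨
  ℕ.∣ b - a ∣     ≡⟨ ℕP.∣-∣-comm b a ⟩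
  ℕ.∣ a - b ∣     ∎
  where open ≡-Reasoning

module Modulo (k : ℕ) where

  m : ℕ
  m = suc k

  infix 4 _≈_
  record _≈_ (a b : ℤ) : Set where
    constructor mk≈
    field m∣a-b : + m Signed.∣ (a - b)

  ≈-isEquivalence : IsEquivalence _≈_
  ≈-isEquivalence = record
    { refl  = λ {a} → mk≈ (subst (+ m Signed.∣_) (self a) (divides 0ℤ refl))
    ; sym   = λ {a} {b} (mk≈ d) → mk≈ (subst (+ m Signed.∣_) (flip a b) (∣m⇒∣-m d))
    ; trans = λ {a} {b} {c} (mk≈ d) (mk≈ e) → mk≈ (subst (+ m Signed.∣_) (chain a b c) (∣m∣n⇒∣m+n d e))
    }
    where
    self : ∀ a → 0ℤ ≡ a - a
    self = solve-∀
    flip : ∀ a b → - (a - b) ≡ b - a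
    flip = solve-∀
    chain : ∀ a b c → (a - b) + (b - c) ≡ a - c
    chain = solve-∀

  ≈-setoid : Setoid _ _
  ≈-setoid = record { isEquivalence = ≈-isEquivalence }

  open IsEquivalence ≈-isEquivalence public
    using () renaming (refl to ≈-refl; sym to ≈-sym; trans to ≈-trans; reflexive to ≈-reflexive)

  +-cong : ∀ {a b c d} → a ≈ b → c ≈ d → a + c ≈ b + d
  +-cong {a} {b} {c} {d} (mk≈ p) (mk≈ q) =
    mk≈ (subst (+ m Signed.∣_) (regroup a b c d) (∣m∣n⇒∣m+n p q))
    where
    regroup : ∀ a b c d → (a - b) + (c - d) ≡ (a + c) - (b + d)
    regroup = solve-∀

  *-cong : ∀ {a b c d} → a ≈ b → c ≈ d → a * c ≈ b * d
  *-cong {a} {b} {c} {d} (mk≈ p) (mk≈ q) =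
    mk≈ (subst (+ m Signed.∣_) (regroup a b c d) (∣m∣n⇒∣m+n (∣m⇒∣m*n c p) (Signed.∣n⇒∣m*n b q)))
    where
    regroup : ∀ a b c d → (a - b) * c + b * (c - d) ≡ a * c - b * d
    regroup = solve-∀

  residue : ℤ → ℕ
  residue a = a %ℕ m

  residue<m : ∀ a → residue a ℕ.< m
  residue<m a = n%ℕd<d a m

  residue≈ : ∀ a → + residue a ≈ a
  residue≈ a = mk≈ (divides (- (a /ℕ m)) (remainder-difference a (+ residue a) (a /ℕ m) (a≡a%ℕn+[a/ℕn]*n a m)))
    where
    remainder-difference : ∀ a r q → a ≡ r + q * + m → r - a ≡ - q * + m
    remainder-difference a r q refl = cancel r q (+ m)
      where
      cancel : ∀ r q n → r - (r + q * n) ≡ - q * n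
      cancel = solve-∀

  ≈⇒≡ : ∀ {a b} → a ℕ.< m → b ℕ.< m → + a ≈ + b → a ≡ b
  ≈⇒≡ {a} {b} a<m b<m (mk≈ p) = ℕP.∣m-n∣≡0⇒m≡n (distance≡0 (ℕ.∣ a - b ∣) m∣distance distance<m)
    where
    m∣distance : m ℕDiv.∣ ℕ.∣ a - b ∣
    m∣distance = subst (m ℕDiv.∣_) (∣+a-+b∣ a b) (∣⇒∣ᵤ p)
    distance<m : ℕ.∣ a - b ∣ ℕ.< m
    distance<m = ℕP.≤-<-trans (ℕP.∣m-n∣≤m⊔n a b) (ℕP.⊔-lub a<m b<m)
    distance≡0 : ∀ d → m ℕDiv.∣ d → d ℕ.< m → d ≡ 0
    distance≡0 zero    _   _   = refl
    distance≡0 (suc d) m∣d d<m = contradiction (ℕDiv.∣⇒≤ m∣d) (ℕP.<⇒≱ d<m)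

  residue-cong : ∀ {a b} → a ≈ b → residue a ≡ residue b
  residue-cong {a} {b} a≈b =
    ≈⇒≡ (residue<m a) (residue<m b) (≈-trans (residue≈ a) (≈-trans a≈b (≈-sym (residue≈ b))))

  residue-injective : ∀ {a b} → residue a ≡ residue b → a ≈ b
  residue-injective {a} {b} eq =
    ≈-trans (≈-sym (residue≈ a)) (≈-trans (≈-reflexive (cong +_ eq)) (residue≈ b))

  -‿cong : ∀ {a b} → a ≈ b → - a ≈ - b
  -‿cong {a} {b} (mk≈ p) = mk≈ (subst (+ m Signed.∣_) (negate a b) (∣m⇒∣-m p))
    where
    negate : ∀ a b → - (a - b) ≡ - a - - b
    negate = solve-∀

  ∣⇒≈0 : ∀ {a} → + m Signed.∣ a → a ≈ 0ℤ
  ∣⇒≈0 {a} p = mk≈ (subst (+ m Signed.∣_) (sym (+-identityʳ a)) p)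

  ≈0⇒∣ : ∀ {a} → a ≈ 0ℤ → + m Signed.∣ a
  ≈0⇒∣ {a} (mk≈ p) = subst (+ m Signed.∣_) (+-identityʳ a) p

  coprime-cancel : ∀ {d y} → Coprime (+ m) d → d * y ≈ 0ℤ → y ≈ 0ℤ
  coprime-cancel {d} {y} m⊥d dy≈0 = ∣⇒≈0 (∣ᵤ⇒∣ (coprime-divisor (+ m) d y m⊥d (∣⇒∣ᵤ (≈0⇒∣ dy≈0))))

  Separated : List ℤ → Set
  Separated = AllPairs (λ s t → Coprime (+ m) (s - t))

  module ≈-Reasoning = Relation.Binary.Reasoning.Setoid ≈-setoid

  quotient-root : ∀ t c cs {s} → eval (c ∷ cs) t ≈ 0ℤ → eval (c ∷ cs) s ≈ 0ℤ →
                  (t - s) * eval (quotient t cs) s ≈ 0ℤ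
  quotient-root t c cs {s} p[t]≈0 p[s]≈0 = begin
    (t - s) * eval (quotient t cs) s  ≡⟨ difference (eval (c ∷ cs) t) t s (eval (quotient t cs) s) ⟩
    p[t] - (p[t] + (s - t) * eval (quotient t cs) s) ≡⟨ cong (λ y → p[t] - y) (eval-quotient t c cs s) ⟨
    p[t] - eval (c ∷ cs) s            ≈⟨ +-cong p[t]≈0 (-‿cong p[s]≈0) ⟩
    0ℤ - 0ℤ                           ≡⟨⟩
    0ℤ                                ∎
    where
    open ≈-Reasoning
    p[t] = eval (c ∷ cs) t
    difference : ∀ a t s q → (t - s) * q ≡ a - (a + (s - t) * q)
    difference = solve-∀

  coefficients-from-quotient : ∀ t c cs → eval (c ∷ cs) t ≈ 0ℤ → All (_≈ 0ℤ) (quotient t cs) →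
                               All (_≈ 0ℤ) (c ∷ cs)
  coefficients-from-quotient t c [] p[t]≈0 [] = ≈-trans (≈-reflexive (constant c t)) p[t]≈0 ∷ []
    where
    constant : ∀ c t → c ≡ c + t * 0ℤ
    constant = solve-∀
  coefficients-from-quotient t c (d ∷ ds) p[t]≈0 (q[t]≈0 ∷ qs≈0) =
    c≈0 ∷ coefficients-from-quotient t d ds q[t]≈0 qs≈0
    where
    c≈0 : c ≈ 0ℤ
    c≈0 = begin
      c                                        ≡⟨ peel c t (eval (d ∷ ds) t) ⟩
      eval (c ∷ d ∷ ds) t - t * eval (d ∷ ds) t ≈⟨ +-cong p[t]≈0 (-‿cong (*-cong (≈-refl {t}) q[t]≈0)) ⟩
      0ℤ - t * 0ℤ                              ≡⟨ zero-product t ⟩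
      0ℤ                                       ∎
      where
      open ≈-Reasoning
      peel : ∀ c t e → c ≡ (c + t * e) - t * e
      peel = solve-∀
      zero-product : ∀ t → 0ℤ - t * 0ℤ ≡ 0ℤ
      zero-product = solve-∀

  roots⇒coefficients≈0 : ∀ p ts → length p ℕ.≤ length ts → Separated ts →
                         All (λ t → eval p t ≈ 0ℤ) ts → All (_≈ 0ℤ) p
  roots⇒coefficients≈0 []       _        _           _          _             = []
  roots⇒coefficients≈0 (c ∷ cs) (t ∷ ts) (s≤s |cs|≤) (t⊥ts ∷ ts#) (p[t]≈0 ∷ p[ts]≈0) =
    coefficients-from-quotient t c cs p[t]≈0
      (roots⇒coefficients≈0 (quotient t cs) ts |q|≤ ts#
        (quotient-roots t⊥ts p[ts]≈0))
    where
    quotient-roots : ∀ {ss} → All (λ s → Coprime (+ m) (t - s)) ss → All (λ s → eval (c ∷ cs) s ≈ 0ℤ) ss →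
                     All (λ s → eval (quotient t cs) s ≈ 0ℤ) ss
    quotient-roots []               []                 = []
    quotient-roots {s ∷ _} (m⊥t-s ∷ m⊥t-ss) (p[s]≈0 ∷ p[ss]≈0) =
      coprime-cancel {t - s} m⊥t-s (quotient-root t c cs p[t]≈0 p[s]≈0) ∷ quotient-roots m⊥t-ss p[ss]≈0
    |q|≤ : length (quotient t cs) ℕ.≤ length ts
    |q|≤ = subst (ℕ._≤ length ts) (sym (length-quotient t cs)) |cs|≤

  digits : ℕ → ℕ → List ℕ
  digits zero    n = []
  digits (suc r) n = n ℕ.% m ∷ digits r (n ℕ./ m)

  fromDigits : List ℕ → ℕ
  fromDigits []       = 0
  fromDigits (d ∷ ds) = d ℕ.+ fromDigits ds ℕ.* m

  length-digits : ∀ r n → length (digits r n) ≡ r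
  length-digits zero    n = refl
  length-digits (suc r) n = cong suc (length-digits r (n ℕ./ m))

  digits<m : ∀ r n → All (ℕ._< m) (digits r n)
  digits<m zero    n = []
  digits<m (suc r) n = DM.m%n<n n m ∷ digits<m r (n ℕ./ m)

  fromDigits-digits : ∀ r {n} → n ℕ.< m ℕ.^ r → fromDigits (digits r n) ≡ n
  fromDigits-digits zero    {zero}  _         = refl
  fromDigits-digits zero    {suc n} (s≤s ())
  fromDigits-digits (suc r) {n} n<m^1+r = begin
    n ℕ.% m ℕ.+ fromDigits (digits r (n ℕ./ m)) ℕ.* m
      ≡⟨ cong (λ y → n ℕ.% m ℕ.+ y ℕ.* m) (fromDigits-digits r n/m<m^r) ⟩
    n ℕ.% m ℕ.+ (n ℕ./ m) ℕ.* m                         ≡⟨ DM.m≡m%n+[m/n]*n n m ⟨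
    n                                                   ∎
    where
    open ≡-Reasoning
    n/m<m^r : n ℕ./ m ℕ.< m ℕ.^ r
    n/m<m^r = DM.m<n*o⇒m/o<n (subst (n ℕ.<_) (ℕP.*-comm m (m ℕ.^ r)) n<m^1+r)

  fromDigits<m^length : ∀ {ds} → All (ℕ._< m) ds → fromDigits ds ℕ.< m ℕ.^ length ds
  fromDigits<m^length []                   = s≤s z≤n
  fromDigits<m^length {d ∷ ds} (d<m ∷ ds<m) = begin-strict
    d ℕ.+ fromDigits ds ℕ.* m      <⟨ ℕP.+-monoˡ-< _ d<m ⟩
    m ℕ.+ fromDigits ds ℕ.* m      ≡⟨⟩
    suc (fromDigits ds) ℕ.* m      ≤⟨ ℕP.*-monoˡ-≤ m (fromDigits<m^length ds<m) ⟩
    m ℕ.^ length ds ℕ.* m          ≡⟨ ℕP.*-comm (m ℕ.^ length ds) m ⟩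
    m ℕ.^ suc (length ds)          ∎
    where open ℕP.≤-Reasoning

  digits-fromDigits : ∀ {ds} → All (ℕ._< m) ds → digits (length ds) (fromDigits ds) ≡ ds
  digits-fromDigits []                     = refl
  digits-fromDigits {d ∷ ds} (d<m ∷ ds<m) =
    cong₂ _∷_ low (trans (cong (digits (length ds)) high) (digits-fromDigits ds<m))
    where
    low : (d ℕ.+ fromDigits ds ℕ.* m) ℕ.% m ≡ d
    low = trans (DM.[m+kn]%n≡m%n d (fromDigits ds) m) (DM.m<n⇒m%n≡m d<m)
    high : (d ℕ.+ fromDigits ds ℕ.* m) ℕ./ m ≡ fromDigits ds
    high = begin
      (d ℕ.+ fromDigits ds ℕ.* m) ℕ./ m           ≡⟨ DM.+-distrib-/ d (fromDigits ds ℕ.* m) no-carry ⟩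
      d ℕ./ m ℕ.+ fromDigits ds ℕ.* m ℕ./ m
        ≡⟨ cong₂ ℕ._+_ (DM.m<n⇒m/n≡0 d<m) (DM.m*n/n≡m (fromDigits ds) m) ⟩
      fromDigits ds                               ∎
      where
      open ≡-Reasoning
      no-carry : d ℕ.% m ℕ.+ (fromDigits ds ℕ.* m) ℕ.% m ℕ.< m
      no-carry = subst₂ (λ a b → a ℕ.+ b ℕ.< m) (sym (DM.m<n⇒m%n≡m d<m)) (sym (DM.m*n%n≡0 (fromDigits ds) m))
                   (subst (ℕ._< m) (sym (ℕP.+-identityʳ d)) d<m)

  coefficients : ℕ → ℕ → List ℤ
  coefficients r n = map +_ (digits r n)

  length-coefficients : ∀ r n → length (coefficients r n) ≡ r
  length-coefficients r n = trans (length-map +_ (digits r n)) (length-digits r n)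

  word : ℕ → (ℕ → ℤ) → ℕ → ℕ → ℕ
  word r h n s = residue (eval (coefficients r n) (+ s) + h s)

  eval-residues : ∀ p x → eval (map (λ a → + residue a) p) x ≈ eval p x
  eval-residues []       x = ≈-refl
  eval-residues (c ∷ cs) x = +-cong (residue≈ c) (*-cong (≈-refl {x}) (eval-residues cs x))

  shift : ∀ r n w → length w ≡ r →
          Σ ℕ λ n′ → n′ ℕ.< m ℕ.^ r × (∀ x → eval (coefficients r n′) x ≈ eval (coefficients r n) x + eval w x)
  shift r n w |w| = fromDigits ds , fromDigits<m^r , eval-shifted
    where
    sum = coefficients r n ⊕ w
    ds = map residue sum
    ds<m : All (ℕ._< m) ds
    ds<m = AllP.map⁺ (All.tabulate (λ {a} _ → residue<m a))
    |ds| : length ds ≡ r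
    |ds| = trans (length-map residue sum)
                 (trans (length-⊕ (coefficients r n) w (trans (length-coefficients r n) (sym |w|)))
                        (length-coefficients r n))
    fromDigits<m^r : fromDigits ds ℕ.< m ℕ.^ r
    fromDigits<m^r = subst (λ l → fromDigits ds ℕ.< m ℕ.^ l) |ds| (fromDigits<m^length ds<m)
    digits-shifted : digits r (fromDigits ds) ≡ ds
    digits-shifted = subst (λ l → digits l (fromDigits ds) ≡ ds) |ds| (digits-fromDigits ds<m)
    eval-shifted : ∀ x → eval (coefficients r (fromDigits ds)) x ≈ eval (coefficients r n) x + eval w x
    eval-shifted x = begin
      eval (map +_ (digits r (fromDigits ds))) x ≡⟨ cong (λ d → eval (map +_ d) x) digits-shifted ⟩
      eval (map +_ (map residue sum)) x        ≡⟨ cong (λ p → eval p x) (map-∘ sum) ⟨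
      eval (map (λ a → + residue a) sum) x      ≈⟨ eval-residues sum x ⟩
      eval sum x                                ≡⟨ eval-⊕ (coefficients r n) w x ⟩
      eval (coefficients r n) x + eval w x      ∎
      where open ≈-Reasoning

  word-retarget : ∀ r h h′ w → length w ≡ r → ∀ n {ps : List ℕ} →
                  All (λ s → h s + eval w (+ s) ≈ h′ s) ps →
                  Σ ℕ λ n′ → n′ ℕ.< m ℕ.^ r × All (λ s → word r h n′ s ≡ word r h′ n s) ps
  word-retarget r h h′ w |w| n agree = n′ , n′<m^r , All.map retarget agree
    where
    open ≈-Reasoning
    E : ℕ → ℤ → ℤ
    E n x = eval (coefficients r n) x
    shifted = shift r n w |w|
    n′ = proj₁ shifted
    n′<m^r = proj₁ (proj₂ shifted)
    eval-n′ = proj₂ (proj₂ shifted)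
    regroup : ∀ a b c → (a + b) + c ≡ a + (c + b)
    regroup = solve-∀
    retarget : ∀ {s} → h s + eval w (+ s) ≈ h′ s → word r h n′ s ≡ word r h′ n s
    retarget {s} hw≈h′ = residue-cong (begin
      E n′ (+ s) + h s                 ≈⟨ +-cong (eval-n′ (+ s)) (≈-refl {h s}) ⟩
      (E n (+ s) + eval w (+ s)) + h s ≡⟨ regroup (E n (+ s)) (eval w (+ s)) (h s) ⟩
      E n (+ s) + (h s + eval w (+ s)) ≈⟨ +-cong (≈-refl {E n (+ s)}) hw≈h′ ⟩
      E n (+ s) + h′ s                 ∎)

  ≈-by-difference : ∀ {a b} → a + -1ℤ * b ≈ 0ℤ → a ≈ b
  ≈-by-difference {a} {b} a-b≈0 = begin
    a                   ≡⟨ split a b ⟩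
    (a + -1ℤ * b) + b   ≈⟨ +-cong a-b≈0 (≈-refl {b}) ⟩
    0ℤ + b              ≡⟨ +-identityˡ b ⟩
    b                   ∎
    where
    open ≈-Reasoning
    split : ∀ a b → a ≡ (a + -1ℤ * b) + b
    split = solve-∀

  digitwise-≈⇒≡ : ∀ {ds ds′} → All (ℕ._< m) ds → All (ℕ._< m) ds′ →
                  All (_≈ 0ℤ) (map +_ ds ⊕ map (-1ℤ *_) (map +_ ds′)) → length ds ≡ length ds′ → ds ≡ ds′
  digitwise-≈⇒≡ []           []             _              _     = refl
  digitwise-≈⇒≡ (d<m ∷ ds<m) (d′<m ∷ ds′<m) (d-d′≈0 ∷ rest) |ds| =
    cong₂ _∷_ (≈⇒≡ d<m d′<m (≈-by-difference d-d′≈0)) (digitwise-≈⇒≡ ds<m ds′<m rest (ℕP.suc-injective |ds|))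

  difference : ℕ → ℕ → ℕ → List ℤ
  difference r n n′ = coefficients r n ⊕ map (-1ℤ *_) (coefficients r n′)

  length-difference : ∀ r n n′ → length (difference r n n′) ≡ r
  length-difference r n n′ = trans (length-⊕ (coefficients r n) _ same-length) (length-coefficients r n)
    where
    same-length : length (coefficients r n) ≡ length (map (-1ℤ *_) (coefficients r n′))
    same-length = trans (length-coefficients r n)
                        (sym (trans (length-map _ (coefficients r n′)) (length-coefficients r n′)))

  word≡⇒difference≈0 : ∀ r h n n′ s → word r h n s ≡ word r h n′ s → eval (difference r n n′) (+ s) ≈ 0ℤ
  word≡⇒difference≈0 r h n n′ s same-word = begin
    eval (difference r n n′) (+ s)                 ≡⟨ eval-⊕ (coefficients r n) _ (+ s) ⟩
    E n + eval (map (-1ℤ *_) (coefficients r n′)) (+ s)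
      ≡⟨ cong (λ y → E n + y) (eval-scale -1ℤ (coefficients r n′) (+ s)) ⟩
    E n + -1ℤ * E n′                               ≡⟨ cancel-h (E n) (E n′) (h s) ⟩
    (E n + h s) + -1ℤ * (E n′ + h s)
      ≈⟨ +-cong (residue-injective {E n + h s} {E n′ + h s} same-word) ≈-refl ⟩
    (E n′ + h s) + -1ℤ * (E n′ + h s)              ≡⟨ self-difference (E n′ + h s) ⟩
    0ℤ                                             ∎
    where
    open ≈-Reasoning
    E : ℕ → ℤ
    E n = eval (coefficients r n) (+ s)
    cancel-h : ∀ a b c → a + -1ℤ * b ≡ (a + c) + -1ℤ * (b + c)
    cancel-h = solve-∀
    self-difference : ∀ a → a + -1ℤ * a ≡ 0ℤ
    self-difference = solve-∀

  word-injective : ∀ r h {n n′} → n ℕ.< m ℕ.^ r → n′ ℕ.< m ℕ.^ r → ∀ {ps} → r ℕ.≤ length ps →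
                   Separated (map +_ ps) → All (λ s → word r h n s ≡ word r h n′ s) ps → n ≡ n′
  word-injective r h {n} {n′} n<m^r n′<m^r {ps} r≤|ps| ps# agree = begin
    n                          ≡⟨ fromDigits-digits r n<m^r ⟨
    fromDigits (digits r n)    ≡⟨ cong fromDigits same-digits ⟩
    fromDigits (digits r n′)   ≡⟨ fromDigits-digits r n′<m^r ⟩
    n′                         ∎
    where
    open ≡-Reasoning
    |difference|≤ : length (difference r n n′) ℕ.≤ length (map +_ ps)
    |difference|≤ = subst₂ ℕ._≤_ (sym (length-difference r n n′)) (sym (length-map +_ ps)) r≤|ps|
    same-digits : digits r n ≡ digits r n′
    same-digits = digitwise-≈⇒≡ (digits<m r n) (digits<m r n′)
      (roots⇒coefficients≈0 (difference r n n′) (map +_ ps) |difference|≤ ps#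
        (AllP.map⁺ (All.map (word≡⇒difference≈0 r h n n′ _) agree)))
      (trans (length-digits r n) (sym (length-digits r n′)))

  1≉0 : 1 ℕ.≤ k → ¬ (1ℤ ≈ 0ℤ)
  1≉0 1≤k 1≈0 = ℕP.<⇒≢ 1≤k (sym (ℕP.suc-injective (ℕDiv.∣1⇒≡1 (∣⇒∣ᵤ (≈0⇒∣ 1≈0)))))

  word-power-nonvanishing : 1 ℕ.≤ k → ∀ r n {ps} → suc r ℕ.≤ length ps → Separated (map +_ ps) →
                            ¬ All (λ s → word r (power r) n s ≡ 0) ps
  word-power-nonvanishing 1≤k r n {ps} r<|ps| ps# vanish =
    1≉0 1≤k (All.head (AllP.++⁻ʳ (coefficients r n) (roots⇒coefficients≈0 monicWord (map +_ ps) |monicWord|≤ ps#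
      (AllP.map⁺ (All.map root vanish)))))
    where
    monicWord = coefficients r n ++ (1ℤ ∷ [])
    |monicWord|≤ : length monicWord ℕ.≤ length (map +_ ps)
    |monicWord|≤ = subst₂ ℕ._≤_
      (sym (trans (length-++ (coefficients r n))
                  (trans (ℕP.+-comm (length (coefficients r n)) 1) (cong suc (length-coefficients r n)))))
      (sym (length-map +_ ps)) r<|ps|
    root : ∀ {s} → word r (power r) n s ≡ 0 → eval monicWord (+ s) ≈ 0ℤ
    root {s} word≡0 = ≈-trans (≈-reflexive leading) (residue-injective {E + power r s} {0ℤ} word≡0)
      where
      E = eval (coefficients r n) (+ s)
      leading : eval monicWord (+ s) ≡ E + power r s
      leading = trans (eval-++-leading (coefficients r n) (+ s))
                      (cong (λ l → E + (+ s) ^ l) (length-coefficients r n))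

  word-zero : ∀ r s → word r zeroOffset 0 s ≡ 0
  word-zero r s = cong (λ a → residue (a + 0ℤ)) (eval-zero r)
    where
    eval-zero : ∀ r → eval (coefficients r 0) (+ s) ≡ 0ℤ
    eval-zero zero    = refl
    eval-zero (suc r) = trans (cong (λ a → 0ℤ + + s * a) (eval-zero r)) (cong (λ a → 0ℤ + a) (*-zeroʳ (+ s)))

∣n! : ∀ {d n} → 1 ℕ.≤ d → d ℕ.≤ n → d ℕDiv.∣ n ℕ.!
∣n! {suc d} _ d≤n = ℕDiv.∣-trans (ℕDiv.m∣m*n (d ℕ.!)) (ℕDiv.m≤n⇒m!∣n! d≤n)

1+n!-coprime : ∀ {d n} → 1 ℕ.≤ d → d ℕ.≤ n → ℕC.Coprime (suc (n ℕ.!)) d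
1+n!-coprime {d} {n} 1≤d d≤n {i} (i∣1+n! , i∣d) =
  ℕDiv.∣1⇒≡1 (ℕDiv.∣m+n∣m⇒∣n (subst (i ℕDiv.∣_) (ℕP.+-comm 1 (n ℕ.!)) i∣1+n!) (ℕDiv.∣-trans i∣d (∣n! 1≤d d≤n)))

separated-below : ∀ B {ps} → Unique ps → All (ℕ._< B) ps → Modulo.Separated (B ℕ.!) (map +_ ps)
separated-below B ps! ps<B = AllPairsP.map⁺ (AllPairs-map-All coprime ps<B ps!)
  where
  coprime : ∀ {s t} → s ℕ.< B → t ℕ.< B → s ≢ t → Coprime (+ suc (B ℕ.!)) (+ s - + t)
  coprime {s} {t} s<B t<B s≢t = subst (ℕC.Coprime (suc (B ℕ.!))) (sym (∣+a-+b∣ s t)) (1+n!-coprime 1≤d d≤B)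
    where
    1≤d : 1 ℕ.≤ ℕ.∣ s - t ∣
    1≤d = ℕP.n≢0⇒n>0 (s≢t ∘′ ℕP.∣m-n∣≡0⇒m≡n)
    d≤B : ℕ.∣ s - t ∣ ℕ.≤ B
    d≤B = ℕP.≤-trans (ℕP.∣m-n∣≤m⊔n s t) (ℕP.<⇒≤ (ℕP.⊔-lub s<B t<B))

-- Cliques spanned by codewords

module CodeCliques (r : ℕ) (U : List ℕ) (U! : Unique U) (b : ℕ) (U≤b : All (_≤ b) U) where

  bound : ℕ
  bound = suc b

  U<bound : All (_< bound) U
  U<bound = All.map s≤s U≤b

  open Modulo (bound ℕ.!) public

  encode : ℕ → ℕ → ℕ
  encode u a = u ℕ.+ a ℕ.* bound

  position : ℕ → ℕ
  position x = x ℕ.% bound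

  position-encode : ∀ {u} a → u < bound → position (encode u a) ≡ u
  position-encode {u} a u<bound = trans (DM.[m+kn]%n≡m%n u a bound) (DM.m<n⇒m%n≡m u<bound)

  encode-injectiveʳ : ∀ u {a a′} → encode u a ≡ encode u a′ → a ≡ a′
  encode-injectiveʳ u eq = ℕP.*-cancelʳ-≡ _ _ bound (ℕP.+-cancelˡ-≡ u _ _ eq)

  vertices : (ℕ → ℕ) → List ℕ
  vertices c = map (λ u → encode u (c u)) U

  ∈-vertices⁻ : ∀ c {x} → x ∈ vertices c → position x ∈ U × x ≡ encode (position x) (c (position x))
  ∈-vertices⁻ c x∈ with ∈-map⁻ (λ u → encode u (c u)) x∈
  ... | u , u∈U , refl rewrite position-encode (c u) (All.lookup U<bound u∈U) = u∈U , refl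

  ∈-vertices⁺ : ∀ c {u} → u ∈ U → encode u (c u) ∈ vertices c
  ∈-vertices⁺ c = ∈-map⁺ (λ u → encode u (c u))

  encode-zero : ∀ u → encode u 0 ≡ u
  encode-zero = ℕP.+-identityʳ

  ∈-vertices-zero : ∀ c → (∀ u → c u ≡ 0) → ∀ x → (x ∈ vertices c) ⇔ (x ∈ U)
  ∈-vertices-zero c c≡0 x = mk⇔ to from
    where
    at-zero : ∀ u → encode u (c u) ≡ u
    at-zero u = trans (cong (encode u) (c≡0 u)) (encode-zero u)
    to : x ∈ vertices c → x ∈ U
    to x∈ with ∈-map⁻ (λ u → encode u (c u)) x∈
    ... | u , u∈U , refl = subst (_∈ U) (sym (at-zero u)) u∈U
    from : x ∈ U → x ∈ vertices c
    from x∈U = subst (_∈ vertices c) (at-zero x) (∈-vertices⁺ c x∈U)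

  value-on-U : ∀ c {u} → u < bound → u ∈ vertices c → c u ≡ 0
  value-on-U c {u} u<bound u∈ with ∈-vertices⁻ c u∈
  ... | _ , u≡ rewrite DM.m<n⇒m%n≡m u<bound = encode-injectiveʳ u (trans (sym u≡) (sym (encode-zero u)))

  same-position⇒≡ : ∀ c {x y} → x ∈ vertices c → y ∈ vertices c → position x ≡ position y → x ≡ y
  same-position⇒≡ c x∈ y∈ eq with ∈-vertices⁻ c x∈ | ∈-vertices⁻ c y∈
  ... | _ , x≡ | _ , y≡ = trans x≡ (trans (cong (λ p → encode p (c p)) eq) (sym y≡))

  vertices-unique : ∀ c → Unique (vertices c)
  vertices-unique c = AllPairsP.map⁺ (AllPairs-map-All distinct U<bound U!)
    where
    distinct : ∀ {u v} → u < bound → v < bound → u ≢ v → encode u (c u) ≢ encode v (c v)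
    distinct {u} {v} u<b v<b u≢v eq =
      u≢v (trans (sym (position-encode (c u) u<b)) (trans (cong position eq) (position-encode (c v) v<b)))

  clique : (ℕ → ℕ) → RGraph
  clique c = complete r (vertices c)

  ∈-clique : ∀ c e → (e ∈ clique c) ⇔ (IsRSet r e × e ⊆ vertices c)
  ∈-clique c = ∈-complete r (vertices-unique c)

  clique-isClique : ∀ c → IsClique (length U) r (clique c)
  clique-isClique c =
    subst (λ l → IsClique l r (clique c)) (length-map _ U) (complete-isClique r (vertices-unique c))

  positions : List ℕ → List ℕ
  positions = map position

  positions-unique : ∀ c {e} → IsSet e → e ⊆ vertices c → Unique (positions e)
  positions-unique c e↑ e⊆ =
    AllPairsP.map⁺ (AllPairs-map-All distinct (All.tabulate e⊆) (AllPairs.map ℕP.<⇒≢ (IsSet⇒Strict e↑)))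
    where
    distinct : ∀ {x y} → x ∈ vertices c → y ∈ vertices c → x ≢ y → position x ≢ position y
    distinct x∈ y∈ x≢y = x≢y ∘′ same-position⇒≡ c x∈ y∈

  positions<bound : ∀ c {e} → e ⊆ vertices c → All (_< bound) (positions e)
  positions<bound c e⊆ = AllP.map⁺ (All.tabulate (λ x∈e → All.lookup U<bound (proj₁ (∈-vertices⁻ c (e⊆ x∈e)))))

  agree-on-positions : ∀ c c′ {e} → e ⊆ vertices c → e ⊆ vertices c′ → All (λ s → c s ≡ c′ s) (positions e)
  agree-on-positions c c′ {e} e⊆ e⊆′ = AllP.map⁺ (All.tabulate agree)
    where
    agree : ∀ {x} → x ∈ e → c (position x) ≡ c′ (position x)
    agree x∈e with ∈-vertices⁻ c (e⊆ x∈e) | ∈-vertices⁻ c′ (e⊆′ x∈e)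
    ... | _ , x≡ | _ , x≡′ = encode-injectiveʳ _ (trans (sym x≡) x≡′)

  ⊆-vertices : ∀ c c′ {e} → e ⊆ vertices c → All (λ s → c s ≡ c′ s) (positions e) → e ⊆ vertices c′
  ⊆-vertices c c′ e⊆ agree {x} x∈e with ∈-vertices⁻ c (e⊆ x∈e)
  ... | p∈U , x≡ = subst (_∈ vertices c′) (sym (trans x≡ (cong (encode (position x)) same-value))) (∈-vertices⁺ c′ p∈U)
    where
    same-value : c (position x) ≡ c′ (position x)
    same-value = All.lookup (AllP.map⁻ agree) x∈e

  N : ℕ
  N = m ℕ.^ r

  codeClique : (ℕ → ℤ) → ℕ → RGraph
  codeClique h n = clique (word r h n)

  edge-determines-word : ∀ h {n n′ e} → n < N → n′ < N → e ∈ codeClique h n → e ∈ codeClique h n′ → n ≡ n′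
  edge-determines-word h {n} {n′} {e} n<N n′<N e∈ e∈′
    with Equivalence.to (∈-clique (word r h n) e) e∈ | Equivalence.to (∈-clique (word r h n′) e) e∈′
  ... | (e↑ , |e|) , e⊆ | _ , e⊆′ =
    word-injective r h n<N n′<N (ℕP.≤-reflexive (sym (trans (length-map position e) |e|)))
      (separated-below bound (positions-unique (word r h n) e↑ e⊆) (positions<bound (word r h n) e⊆))
      (agree-on-positions (word r h n) (word r h n′) e⊆ e⊆′)

  Interpolable : (ℕ → ℤ) → (ℕ → ℤ) → Set
  Interpolable h h′ = ∀ (ps : List ℕ) → length ps ≡ r →
                      Σ (List ℤ) λ w → length w ≡ r × All (λ s → h s + eval w (+ s) ≈ h′ s) ps

  edge-retarget : ∀ {h h′} → Interpolable h h′ → ∀ {n e} → e ∈ codeClique h′ n →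
                  Σ ℕ λ n′ → n′ < N × e ∈ codeClique h n′
  edge-retarget {h} {h′} interpolable {n} {e} e∈ with Equivalence.to (∈-clique (word r h′ n) e) e∈
  ... | (e↑ , |e|) , e⊆ with interpolable (positions e) (trans (length-map position e) |e|)
  ... | w , |w| , w-interpolates =
    let n′ , n′<N , same = word-retarget r h h′ w |w| n w-interpolates in
    n′ , n′<N , Equivalence.from (∈-clique (word r h n′) e)
                  ((e↑ , |e|) , ⊆-vertices (word r h′ n) (word r h n′) e⊆ (All.map sym same))

-- The booster

module Booster (q r : ℕ) (1≤r : 1 ≤ r) (r<q : r < q) (S : RGraph) (U : List ℕ) (U↑ : IsSet U)
               (|U| : length U ≡ q) (S⇔ : ∀ e → (e ∈ S) ⇔ (IsRSet r e × e ⊆ U))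
               (b : ℕ) (U≤b : All (_≤ b) U) where

  U! : Unique U
  U! = AllPairs.map ℕP.<⇒≢ (IsSet⇒Strict U↑)

  open CodeCliques r U U! b U≤b public

  K L : ℕ → RGraph
  K = codeClique zeroOffset
  L = codeClique (power r)

  power-interpolable : Interpolable zeroOffset (power r)
  power-interpolable ps |ps| = w , |w| , All.tabulate interpolates
    where
    w = powerInterpolant (map +_ ps)
    |w| : length w ≡ r
    |w| = trans (length-powerInterpolant (map +_ ps)) (trans (length-map +_ ps) |ps|)
    interpolates : ∀ {s} → s ∈ ps → 0ℤ + eval w (+ s) ≈ power r s
    interpolates {s} s∈ = ≈-reflexive (trans (+-identityˡ _)
      (trans (eval-powerInterpolant (map +_ ps) (∈-map⁺ +_ s∈))
             (cong ((+ s) ℤ.^_) (trans (length-map +_ ps) |ps|))))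

  negated-power-interpolable : Interpolable (power r) zeroOffset
  negated-power-interpolable ps |ps| with power-interpolable ps |ps|
  ... | w , |w| , interpolates = map (-1ℤ *_) w , trans (length-map _ w) |w| , All.map negate interpolates
    where
    negate : ∀ {s} → 0ℤ + eval w (+ s) ≈ power r s → power r s + eval (map (-1ℤ *_) w) (+ s) ≈ 0ℤ
    negate {s} w≈ = begin
      power r s + eval (map (-1ℤ *_) w) (+ s) ≡⟨ cong (λ a → power r s + a) (eval-scale -1ℤ w (+ s)) ⟩
      power r s + -1ℤ * eval w (+ s)          ≈⟨ +-cong (≈-sym w≈) ≈-refl ⟩
      (0ℤ + eval w (+ s)) + -1ℤ * eval w (+ s) ≡⟨ cancel (eval w (+ s)) ⟩
      0ℤ                                      ∎
      where
      open ≈-Reasoning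
      cancel : ∀ a → (0ℤ + a) + -1ℤ * a ≡ 0ℤ
      cancel = solve-∀

  nonzero : List ℕ
  nonzero = applyUpTo suc (ℕ.pred N)

  ∈-nonzero⁻ : ∀ {n} → n ∈ nonzero → Σ ℕ λ j → n ≡ suc j × suc j < N
  ∈-nonzero⁻ n∈ with ∈-applyUpTo⁻ suc n∈
  ... | j , j<pred[N] , refl = j , refl , ℕP.pred-cancel-< j<pred[N]

  ∈-nonzero⁺ : ∀ {j} → suc j < N → suc j ∈ nonzero
  ∈-nonzero⁺ 1+j<N = ∈-applyUpTo⁺ suc (ℕP.<⇒≤pred 1+j<N)

  nonzero<N : ∀ {n} → n ∈ nonzero → n < N
  nonzero<N n∈ with ∈-nonzero⁻ n∈
  ... | _ , refl , 1+j<N = 1+j<N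

  nonzero-unique : Unique nonzero
  nonzero-unique = UniqueP.applyUpTo⁺₁ suc (ℕ.pred N) (λ i<j _ → ℕP.<⇒≢ i<j ∘′ ℕP.suc-injective)

  0<N : 0 < N
  0<N = ℕP.m^n>0 m r

  booster : RGraph
  booster = concatMap K nonzero

  ∈-booster⁻ : ∀ {e} → e ∈ booster → Σ ℕ λ n → n ∈ nonzero × e ∈ K n
  ∈-booster⁻ e∈ = find (∈-concatMap⁻ K e∈)

  ∈-booster⁺ : ∀ {n e} → n ∈ nonzero → e ∈ K n → e ∈ booster
  ∈-booster⁺ n∈ e∈ = ∈-concatMap⁺ K (lose n∈ e∈)

  K0⇔S : ∀ e → (e ∈ K 0) ⇔ (e ∈ S)
  K0⇔S e = mk⇔ to from
    where
    vertices⇔U : ∀ x → (x ∈ vertices (word r zeroOffset 0)) ⇔ (x ∈ U)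
    vertices⇔U = ∈-vertices-zero (word r zeroOffset 0) (word-zero r)
    to : e ∈ K 0 → e ∈ S
    to e∈ with Equivalence.to (∈-clique (word r zeroOffset 0) e) e∈
    ... | e-rset , e⊆ = Equivalence.from (S⇔ e) (e-rset , λ {x} x∈e → Equivalence.to (vertices⇔U x) (e⊆ x∈e))
    from : e ∈ S → e ∈ K 0
    from e∈ with Equivalence.to (S⇔ e) e∈
    ... | e-rset , e⊆ =
      Equivalence.from (∈-clique (word r zeroOffset 0) e) (e-rset , λ {x} x∈e → Equivalence.from (vertices⇔U x) (e⊆ x∈e))

  codeClique-isClique : ∀ h n → IsClique q r (codeClique h n)
  codeClique-isClique h n = subst (λ l → IsClique l r (codeClique h n)) |U| (clique-isClique (word r h n))

  booster-isRGraph : IsRGraph r booster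
  booster-isRGraph {e} e∈ with ∈-booster⁻ e∈
  ... | n , _ , e∈K = proj₁ (Equivalence.to (∈-clique (word r zeroOffset n) e) e∈K)

  booster-independent : IndependentIn S booster
  booster-independent {e} e∈ e⊆V[S] with ∈-booster⁻ e∈
  ... | n , n∈ , e∈K with ∈-nonzero⁻ n∈
  ... | j , refl , 1+j<N =
    ℕP.0≢1+n (edge-determines-word zeroOffset 0<N 1+j<N (Equivalence.from (K0⇔S e) e∈S) e∈K)
    where
    e⊆U : e ⊆ U
    e⊆U x∈e with e⊆V[S] x∈e
    ... | f , f∈S , x∈f = proj₂ (Equivalence.to (S⇔ f) f∈S) x∈f
    e∈S : e ∈ S
    e∈S = Equivalence.from (S⇔ e) (proj₁ (Equivalence.to (∈-clique (word r zeroOffset (suc j)) e) e∈K) , e⊆U)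

  off : IsDecomposition q r (map K nonzero) booster
  off = family-isDecomposition K q r nonzero nonzero-unique (λ {n} _ → codeClique-isClique zeroOffset n)
          ∈-booster⁺ ∈-booster⁻
          (λ a∈ b∈ → edge-determines-word zeroOffset (nonzero<N a∈) (nonzero<N b∈))

  on : IsDecomposition q r (map L (upTo N)) (booster ++ S)
  on = family-isDecomposition L q r (upTo N) (UniqueP.upTo⁺ N) (λ {n} _ → codeClique-isClique (power r) n)
         (λ _ → ⊆booster++S) cover
         (λ a∈ b∈ → edge-determines-word (power r) (∈-upTo⁻ a∈) (∈-upTo⁻ b∈))
    where
    ⊆booster++S : ∀ {n e} → e ∈ L n → e ∈ booster ++ S
    ⊆booster++S {n} {e} e∈L = place (edge-retarget power-interpolable e∈L)
      where
      place : (Σ ℕ λ n′ → n′ < N × e ∈ K n′) → e ∈ booster ++ S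
      place (zero  , _     , e∈K) = ∈-++⁺ʳ booster (Equivalence.to (K0⇔S e) e∈K)
      place (suc j , 1+j<N , e∈K) = ∈-++⁺ˡ (∈-booster⁺ (∈-nonzero⁺ 1+j<N) e∈K)
    in-some-K : ∀ {e} → e ∈ booster ++ S → Σ ℕ λ n → e ∈ K n
    in-some-K {e} e∈ = [ (λ e∈B → let n , _ , e∈K = ∈-booster⁻ e∈B in n , e∈K)
                       , (λ e∈S → 0 , Equivalence.from (K0⇔S e) e∈S) ]′ (∈-++⁻ booster e∈)
    cover : ∀ {e} → e ∈ booster ++ S → Σ ℕ λ n → n ∈ upTo N × e ∈ L n
    cover {e} e∈ =
      let n , e∈K = in-some-K e∈
          n′ , n′<N , e∈L = edge-retarget negated-power-interpolable e∈K
      in n′ , ∈-upTo⁺ n′<N , e∈L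

  on-avoids-S : ∀ {C} → C ∈ map L (upTo N) → ¬ (C ≈G S)
  on-avoids-S C∈ C≈S with ∈-map⁻ L C∈
  ... | n , _ , refl =
    word-power-nonvanishing (ℕP.1≤n! bound) r n (subst (suc r ≤_) (sym |U|) r<q) (separated-below bound U! U<bound)
      (All.tabulate vanishes)
    where
    vanishes : ∀ {u} → u ∈ U → word r (power r) n u ≡ 0
    vanishes {u} u∈U with clique-covers 1≤r (subst (r ≤_) (sym |U|) (ℕP.<⇒≤ r<q)) U↑ S⇔ u∈U
    ... | f , f∈S , u∈f =
      value-on-U (word r (power r) n) (All.lookup U<bound u∈U)
        (proj₂ (Equivalence.to (∈-clique (word r (power r) n) f) (Equivalence.from (C≈S f) f∈S)) u∈f)

lemma2p3 : (q r : ℕ) → 1 ≤ r → r < q → (S : RGraph) → IsRGraph r S →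
    IsClique q r S → Σ RGraph λ B → IsBooster q r S B
lemma2p3 q r 1≤r r<q S _ (U , (U↑ , |U|) , S⇔) =
  booster , booster-isRGraph , booster-independent , (map K nonzero , off) , (map L (upTo N) , on , on-avoids-S)
  where open Booster q r 1≤r r<q S U U↑ |U| S⇔ (max 0 U) (xs≤max 0 U)
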